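{- Let $t\ge3$ be an integer. Every $t$-villa is $(2P_3,C_4,C_6,C_7,T_0)$-free and contains an induced $t$-pentagon. Moreover, every $t$-villa is anticonnected and contains no simplicial and no universal vertices.
   Context: All graphs are finite, simple and nonnull. $G$ is $H$-free if no induced subgraph is isomorphic to $H$. $C_k$: cycle on $k$ vertices; $2P_3$: disjoint union of two 3-vertex paths. $T_0$ is the graph with vertex set $\{p,p',q_0,q_1,q_2,q_3,r_1,r_2,r_3\}$ and exactly the edges $pp',pq_0,pq_2,pq_3,p'q_1,p'q_2,p'q_3,q_0r_1,q_1r_1,q_2r_2,q_3r_3,r_1r_2,r_1r_3,r_2r_3$. The $t$-pentagon has vertices $a,b_1,\dots,b_t,c_1,\dots,c_t$, with $a$ adjacent to all $b_i$ and no $c_i$, the $b_i$ pairwise nonadjacent, the $c_i$ pairwise adjacent, and $b_ic_j$ an edge iff $i=j$. Clique: possibly empty set of pairwise adjacent vertices; simplicial vertex: neighborhood is a clique; universal vertex: adjacent to all others; anticonnected: complement is connected. Complete/anticomplete: every vertex of one set adjacent/nonadjacent to every vertex of the other. $t$-villa: a graph $Q$ whose vertex set is partitioned into nonempty cliques $A,B_1,\dots,B_t,C_1,\dots,C_t$ with $A$ complete to $B_1\cup\dots\cup B_t$ and anticomplete to $C_1\cup\dots\cup C_t$; $B_1,\dots,B_t$ pairwise anticomplete; $C_1,\dots,C_t$ pairwise complete; $B_i$ anticomplete to $C_j$ for $i\ne j$; each $B_i$ can be ordered $b^i_1,\dots,b^i_{r_i}$ with $\emptyset\ne N(b^i_{r_i})\cap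 C_i\subseteq\dots\subseteq N(b^i_1)\cap C_i=C_i$. -}

module Defs where

open import Data.Nat using (ℕ; zero; suc; _<_)
open import Data.Fin using (Fin; zero; suc; #_; inject₁; fromℕ; _≟_)
open import Data.Bool using (Bool; true; false; not; _∧_; _∨_)
open import Data.List using (List; []; _∷_)
open import Data.Bool.ListAction using (any)
open import Data.Product using (Σ; ∃; _×_; _,_)
open import Relation.Nullary using (¬_; does)
open import Relation.Binary.PropositionalEquality using (_≡_; _≢_)

record Graph : Set where
  field
    n       : ℕ
    adj     : Fin n → Fin n → Bool
    sym     : ∀ u v → adj u v ≡ adj v u
    irrefl  : ∀ v → adj v v ≡ false
    nonnull : 0 < n
open Graph public

Adj : (G : Graph) → Fin (n G) → Fin (n G) → Set
Adj G u v = adj G u v ≡ true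

ContainsInduced : {V : Set} → (V → V → Bool) → Graph → Set
ContainsInduced {V} adjH G =
  Σ (V → Fin (n G)) λ f →
    (∀ x y → f x ≡ f y → x ≡ y) ×
    (∀ x y → adjH x y ≡ adj G (f x) (f y))

Free : {V : Set} → (V → V → Bool) → Graph → Set
Free adjH G = ¬ ContainsInduced adjH G

fromEdges : {k : ℕ} → List (Fin k × Fin k) → Fin k → Fin k → Bool
fromEdges es i j =
  any (λ { (a , b) → (does (a ≟ i) ∧ does (b ≟ j)) ∨ (does (a ≟ j) ∧ does (b ≟ i)) }) es

twoP3 : Fin 6 → Fin 6 → Bool
twoP3 = fromEdges ((# 0 , # 1) ∷ (# 1 , # 2) ∷ (# 3 , # 4) ∷ (# 4 , # 5) ∷ [])

C4 : Fin 4 → Fin 4 → Bool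
C4 = fromEdges ((# 0 , # 1) ∷ (# 1 , # 2) ∷ (# 2 , # 3) ∷ (# 3 , # 0) ∷ [])

C6 : Fin 6 → Fin 6 → Bool
C6 = fromEdges ((# 0 , # 1) ∷ (# 1 , # 2) ∷ (# 2 , # 3) ∷ (# 3 , # 4) ∷
                (# 4 , # 5) ∷ (# 5 , # 0) ∷ [])

C7 : Fin 7 → Fin 7 → Bool
C7 = fromEdges ((# 0 , # 1) ∷ (# 1 , # 2) ∷ (# 2 , # 3) ∷ (# 3 , # 4) ∷
                (# 4 , # 5) ∷ (# 5 , # 6) ∷ (# 6 , # 0) ∷ [])

-- T0 with vertices numbered p=0, p'=1, q0=2, q1=3, q2=4, q3=5, r1=6, r2=7, r3=8
T0 : Fin 9 → Fin 9 → Bool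
T0 = fromEdges
  ( (# 0 , # 1) ∷ (# 0 , # 2) ∷ (# 0 , # 4) ∷ (# 0 , # 5)
  ∷ (# 1 , # 3) ∷ (# 1 , # 4) ∷ (# 1 , # 5)
  ∷ (# 2 , # 6) ∷ (# 3 , # 6) ∷ (# 4 , # 7) ∷ (# 5 , # 8)
  ∷ (# 6 , # 7) ∷ (# 6 , # 8) ∷ (# 7 , # 8) ∷ [])

data PentV (t : ℕ) : Set where
  pa : PentV t
  pb : Fin t → PentV t
  pc : Fin t → PentV t

pentagon : (t : ℕ) → PentV t → PentV t → Bool
pentagon t pa     (pb _) = true
pentagon t (pb _) pa     = true
pentagon t (pb i) (pc j) = does (i ≟ j)
pentagon t (pc j) (pb i) = does (i ≟ j)
pentagon t (pc i) (pc j) = not (does (i ≟ j))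
pentagon t _      _      = false

CoAdj : (G : Graph) → Fin (n G) → Fin (n G) → Set
CoAdj G u v = (u ≢ v) × (adj G u v ≡ false)

data CoReach (G : Graph) : Fin (n G) → Fin (n G) → Set where
  here : ∀ {u} → CoReach G u u
  step : ∀ {u v w} → CoAdj G u v → CoReach G v w → CoReach G u w

Anticonnected : Graph → Set
Anticonnected G = ∀ u v → CoReach G u v

Simplicial : (G : Graph) → Fin (n G) → Set
Simplicial G v = ∀ x y → Adj G v x → Adj G v y → x ≢ y → Adj G x y

Universal : (G : Graph) → Fin (n G) → Set
Universal G v = ∀ u → u ≢ v → Adj G v u

-- t-villa: partition of V(G) into A, B_1..B_t, C_1..C_t given by a labelling

data VLabel (t : ℕ) : Set where
  LA : VLabel t
  LB : Fin t → VLabel t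
  LC : Fin t → VLabel t

record IsVilla (t : ℕ) (G : Graph) : Set where
  field
    lab       : Fin (n G) → VLabel t
    nonempty  : ∀ l → ∃ λ v → lab v ≡ l
    cliques   : ∀ u v → u ≢ v → lab u ≡ lab v → Adj G u v
    A-B       : ∀ u v i → lab u ≡ LA → lab v ≡ LB i → Adj G u v
    A-C       : ∀ u v i → lab u ≡ LA → lab v ≡ LC i → adj G u v ≡ false
    B-B       : ∀ u v i j → i ≢ j → lab u ≡ LB i → lab v ≡ LB j → adj G u v ≡ false
    C-C       : ∀ u v i j → i ≢ j → lab u ≡ LC i → lab v ≡ LC j → Adj G u v
    B-C       : ∀ u v i j → i ≢ j → lab u ≡ LB i → lab v ≡ LC j → adj G u v ≡ false
    -- B_i = {σ 0, …, σ r} (an enumeration without repetition) with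
    -- C_i = N(σ 0) ∩ C_i ⊇ N(σ 1) ∩ C_i ⊇ … ⊇ N(σ r) ∩ C_i ≠ ∅
    ordering  : ∀ i → Σ ℕ λ r → Σ (Fin (suc r) → Fin (n G)) λ σ →
                  (∀ k l → σ k ≡ σ l → k ≡ l) ×
                  (∀ v → lab v ≡ LB i → ∃ λ k → σ k ≡ v) ×
                  (∀ k → lab (σ k) ≡ LB i) ×
                  (∀ c → lab c ≡ LC i → Adj G (σ zero) c) ×
                  (∀ (k : Fin r) c → lab c ≡ LC i →
                     Adj G (σ (suc k)) c → Adj G (σ (inject₁ k)) c) ×
                  (∃ λ c → lab c ≡ LC i × Adj G (σ (fromℕ r)) c)

{-# OPTIONS --safe #-}
-- Write C for C₁ ∪ … ∪ Cₜ and B for B₁ ∪ … ∪ Bₜ. In a villa C is a clique, every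
-- non-neighbour of a vertex of A lies in C, and B induces a disjoint union of cliques;
-- hence every induced P3 whose centre is not in A meets C. In 2P3, C6, C7 and T0 every
-- vertex v is anticomplete to some induced P3 x-y-z. Then v ∉ A, since {v, x, z} is
-- stable, and v ∉ C, since the P3 would contain a vertex of C non-adjacent to v. So
-- every vertex lies in B, which contains no induced P3. In C4 a vertex of A forces its
-- two non-adjacent neighbours into the same Bⱼ. A vertex of C yields b, b′ ∈ Bᵢ and
-- c, c′ ∈ Cᵢ with bc, b′c′ edges and bc′, b′c non-edges, which the nested neighbourhoods
-- N(b) ∩ Cᵢ forbid. The t-pentagon is a vertex of A together with one edge bᵢcᵢ from each
-- branch. The last three properties follow from non-edges between distinct branches.
module Submission where

open import Defs
open import Data.Nat using (ℕ; _≤_)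
open import Data.Fin using (Fin)
open import Data.Product using (_×_)
open import Relation.Nullary using (¬_)

open import Data.Bool using (Bool; T; not; if_then_else_)
import Data.Bool.Properties as Bool
open import Data.Empty using (⊥; ⊥-elim)
open import Data.Fin using (zero; suc; #_; inject₁; toℕ; punchIn; _≟_)
  renaming (_≤_ to _≤ᶠ_)
open import Data.Fin.Induction using (<-weakInduction-startingFrom)
open import Data.Fin.Properties using (all?; ≤fromℕ; punchInᵢ≢i) renaming (≤-total to ≤ᶠ-total)
open import Data.Nat using (suc; s≤s; _+_; _<ᵇ_)
open import Data.Nat.DivMod using (_mod_)
open import Data.Product using (Σ; ∃; _,_; proj₁; proj₂)
open import Data.Sum using (_⊎_; inj₁; inj₂; map)
open import Data.Vec using (Vec; []; _∷_; lookup)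
open import Function using (_∘_; id)
open import Function.Bundles using (Equivalence)
open import Relation.Nullary using (Dec; yes; no)
open import Relation.Nullary.Decidable using (False; from-yes; toWitnessFalse; _×-dec_; _→-dec_)
open import Relation.Binary.PropositionalEquality using (_≡_; _≢_; refl; trans)
import Relation.Binary.PropositionalEquality as ≡

IsInducedEmbedding : {V W : Set} → (V → V → Bool) → (W → W → Bool) → (V → W) → Set
IsInducedEmbedding H K f = (∀ x y → f x ≡ f y → x ≡ y) × (∀ x y → H x y ≡ K (f x) (f y))

isInducedEmbedding? : ∀ {a b} (H : Fin a → Fin a → Bool) (K : Fin b → Fin b → Bool)
                      (f : Fin a → Fin b) → Dec (IsInducedEmbedding H K f)
isInducedEmbedding? H K f =
  (all? λ x → all? λ y → (f x ≟ f y) →-dec (x ≟ y)) ×-dec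
  (all? λ x → all? λ y → H x y Bool.≟ K (f x) (f y))

module InducedCopies (G : Graph) where

  containsInduced-∘ : {V W : Set} {H : V → V → Bool} {K : W → W → Bool} {f : V → W} →
                      IsInducedEmbedding H K f → ContainsInduced K G → ContainsInduced H G
  containsInduced-∘ {f = f} (f-inj , f-pres) (g , g-inj , g-pres) =
    g ∘ f ,
    (λ x y → f-inj x y ∘ g-inj (f x) (f y)) ,
    (λ x y → trans (f-pres x y) (g-pres (f x) (f y)))

  at-every-vertex : ∀ {m} {V : Set} {P : Fin (suc m) → Fin (suc m) → Bool} {H : V → V → Bool}
                    (Q : Fin (n G) → Set) (around : V → Vec V m) →
                    (∀ v → IsInducedEmbedding P H (lookup (v ∷ around v))) →
                    ((q : ContainsInduced P G) → Q (proj₁ q zero)) →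
                    (e : ContainsInduced H G) → ∀ v → Q (proj₁ e v)
  at-every-vertex _ around embeds Q₀ e v = Q₀ (containsInduced-∘ (embeds v) e)

  edge : ∀ {k} {H : Fin k → Fin k → Bool} (e : ContainsInduced H G) →
         ∀ x y → {T (H x y)} → Adj G (proj₁ e x) (proj₁ e y)
  edge (_ , _ , pres) x y {xy} = trans (≡.sym (pres x y)) (Equivalence.to Bool.T-≡ xy)

  coedge : ∀ {k} {H : Fin k → Fin k → Bool} (e : ContainsInduced H G) →
           ∀ x y → {False (x ≟ y)} → {T (not (H x y))} → CoAdj G (proj₁ e x) (proj₁ e y)
  coedge (_ , inj , pres) x y {x≢y} {¬xy} =
    toWitnessFalse x≢y ∘ inj x y ,
    trans (≡.sym (pres x y)) (Equivalence.to Bool.T-not-≡ ¬xy)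

K1+P3 : Fin 4 → Fin 4 → Bool
K1+P3 = fromEdges ((# 1 , # 2) ∷ (# 2 , # 3) ∷ [])
  where open import Data.List using ([]; _∷_)

-- far v is an induced P3 of H containing neither v nor a neighbour of v
FarP3s : {V : Set} → (V → V → Bool) → (V → Vec V 3) → Set
FarP3s H far = ∀ v → IsInducedEmbedding K1+P3 H (lookup (v ∷ far v))

farP3s? : ∀ {k} (H : Fin k → Fin k → Bool) (far : Fin k → Vec (Fin k) 3) → Dec (FarP3s H far)
farP3s? H far = all? λ v → isInducedEmbedding? K1+P3 H (lookup (v ∷ far v))

infixl 6 _⊕_
_⊕_ : ∀ {k} → Fin (suc k) → ℕ → Fin (suc k)
_⊕_ {k} i m = (toℕ i + m) mod suc k

twoP3-far-P3 : Fin 6 → Vec (Fin 6) 3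
twoP3-far-P3 v = if toℕ v <ᵇ 3 then # 3 ∷ # 4 ∷ # 5 ∷ [] else # 0 ∷ # 1 ∷ # 2 ∷ []

cycle-far-P3 : ∀ {k} → Fin (suc k) → Vec (Fin (suc k)) 3
cycle-far-P3 v = v ⊕ 2 ∷ v ⊕ 3 ∷ v ⊕ 4 ∷ []

T0-far-P3 : Fin 9 → Vec (Fin 9) 3
T0-far-P3 = lookup
  ( (# 3 ∷ # 6 ∷ # 7 ∷ [])
  ∷ (# 2 ∷ # 6 ∷ # 7 ∷ [])
  ∷ (# 1 ∷ # 4 ∷ # 7 ∷ [])
  ∷ (# 0 ∷ # 4 ∷ # 7 ∷ [])
  ∷ (# 2 ∷ # 6 ∷ # 3 ∷ [])
  ∷ (# 2 ∷ # 6 ∷ # 3 ∷ [])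
  ∷ (# 4 ∷ # 0 ∷ # 5 ∷ [])
  ∷ (# 2 ∷ # 0 ∷ # 5 ∷ [])
  ∷ (# 2 ∷ # 0 ∷ # 4 ∷ [])
  ∷ [])

twoP3-farP3s : FarP3s twoP3 twoP3-far-P3
twoP3-farP3s = from-yes (farP3s? twoP3 twoP3-far-P3)

C6-farP3s : FarP3s C6 cycle-far-P3
C6-farP3s = from-yes (farP3s? C6 cycle-far-P3)

C7-farP3s : FarP3s C7 cycle-far-P3
C7-farP3s = from-yes (farP3s? C7 cycle-far-P3)

T0-farP3s : FarP3s T0 T0-far-P3
T0-farP3s = from-yes (farP3s? T0 T0-far-P3)

C4-rotation : Fin 4 → Vec (Fin 4) 3
C4-rotation v = v ⊕ 1 ∷ v ⊕ 2 ∷ v ⊕ 3 ∷ []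

C4-rotation-induced : ∀ v → IsInducedEmbedding C4 C4 (lookup (v ∷ C4-rotation v))
C4-rotation-induced =
  from-yes (all? λ v → isInducedEmbedding? C4 C4 (lookup (v ∷ C4-rotation v)))

module GraphProperties (G : Graph) where

  adj-sym : ∀ {u v} → Adj G u v → Adj G v u
  adj-sym {u} {v} = trans (sym G v u)

  coAdj-sym : ∀ {u v} → CoAdj G u v → CoAdj G v u
  coAdj-sym {u} {v} (u≢v , u≁v) = u≢v ∘ ≡.sym , trans (sym G v u) u≁v

  adj⇒¬coAdj : ∀ {u v} → Adj G u v → ¬ CoAdj G u v
  adj⇒¬coAdj u~v (_ , u≁v) with trans (≡.sym u~v) u≁v
  ... | ()

  coReach-trans : ∀ {u v w} → CoReach G u v → CoReach G v w → CoReach G u w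
  coReach-trans here        q = q
  coReach-trans (step uv p) q = step uv (coReach-trans p q)

  coReach-sym : ∀ {u v} → CoReach G u v → CoReach G v u
  coReach-sym here        = here
  coReach-sym (step uv p) = coReach-trans (coReach-sym p) (step (coAdj-sym uv) here)

  coAdj⇒¬universal : ∀ {v u} → CoAdj G v u → ¬ Universal G v
  coAdj⇒¬universal v≁u v-univ = adj⇒¬coAdj (v-univ _ (proj₁ v≁u ∘ ≡.sym)) v≁u

  coAdj-neighbours⇒¬simplicial : ∀ {v x y} → Adj G v x → Adj G v y → CoAdj G x y →
                                 ¬ Simplicial G v
  coAdj-neighbours⇒¬simplicial v~x v~y x≁y v-simp =
    adj⇒¬coAdj (v-simp _ _ v~x v~y (proj₁ x≁y)) x≁y

predecessor-closed⇒downward-closed : ∀ {r} (P : Fin (suc r) → Set) →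
  (∀ j → P (suc j) → P (inject₁ j)) → ∀ {k l} → k ≤ᶠ l → P l → P k
predecessor-closed⇒downward-closed P P-pred {k} =
  <-weakInduction-startingFrom (λ j → P j → P k) id (λ j Pj⇒Pk → Pj⇒Pk ∘ P-pred j)

module Villa {t : ℕ} {G : Graph} (villa : IsVilla t G) where
  open IsVilla villa
  open GraphProperties G
  open InducedCopies G

  V : Set
  V = Fin (n G)

  InA InB InC : V → Set
  InA v = lab v ≡ LA
  InB v = ∃ λ i → lab v ≡ LB i
  InC v = ∃ λ i → lab v ≡ LC i

  data Kind (v : V) : Set where
    inA : InA v → Kind v
    inB : ∀ i → lab v ≡ LB i → Kind v
    inC : ∀ i → lab v ≡ LC i → Kind v

  kind : ∀ v → Kind v
  kind v with lab v in v∈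
  ... | LA   = inA v∈
  ... | LB i = inB i v∈
  ... | LC i = inC i v∈

  hub : V
  hub = proj₁ (nonempty LA)

  hub∈A : InA hub
  hub∈A = proj₂ (nonempty LA)

  labels-differ : ∀ {u v l l′} → lab u ≡ l → lab v ≡ l′ → l ≢ l′ → u ≢ v
  labels-differ refl refl l≢l′ refl = l≢l′ refl

  same-label⇒adj : ∀ {u v l} → u ≢ v → lab u ≡ l → lab v ≡ l → Adj G u v
  same-label⇒adj u≢v u∈ v∈ = cliques _ _ u≢v (trans u∈ (≡.sym v∈))

  A-C-coAdj : ∀ {a c i} → InA a → lab c ≡ LC i → CoAdj G a c
  A-C-coAdj a∈A c∈Ci = labels-differ a∈A c∈Ci (λ ()) , A-C _ _ _ a∈A c∈Ci

  B-B-coAdj : ∀ {b b′ i j} → i ≢ j → lab b ≡ LB i → lab b′ ≡ LB j → CoAdj G b b′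
  B-B-coAdj i≢j b∈Bi b′∈Bj =
    labels-differ b∈Bi b′∈Bj (λ { refl → i≢j refl }) , B-B _ _ _ _ i≢j b∈Bi b′∈Bj

  B-C-coAdj : ∀ {b c i j} → i ≢ j → lab b ≡ LB i → lab c ≡ LC j → CoAdj G b c
  B-C-coAdj i≢j b∈Bi c∈Cj = labels-differ b∈Bi c∈Cj (λ ()) , B-C _ _ _ _ i≢j b∈Bi c∈Cj

  adj-B-B⇒same-branch : ∀ {x y i j} → lab x ≡ LB i → lab y ≡ LB j → Adj G x y → i ≡ j
  adj-B-B⇒same-branch {i = i} {j} x∈Bi y∈Bj x~y with i ≟ j
  ... | yes i≡j = i≡j
  ... | no  i≢j = ⊥-elim (adj⇒¬coAdj x~y (B-B-coAdj i≢j x∈Bi y∈Bj))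

  adj-B-C⇒same-branch : ∀ {x y i j} → lab x ≡ LB i → lab y ≡ LC j → Adj G x y → i ≡ j
  adj-B-C⇒same-branch {i = i} {j} x∈Bi y∈Cj x~y with i ≟ j
  ... | yes i≡j = i≡j
  ... | no  i≢j = ⊥-elim (adj⇒¬coAdj x~y (B-C-coAdj i≢j x∈Bi y∈Cj))

  C-clique : ∀ {u v} → InC u → InC v → ¬ CoAdj G u v
  C-clique {u} {v} (i , u∈Ci) (j , v∈Cj) u≁v with i ≟ j
  ... | yes refl = adj⇒¬coAdj (same-label⇒adj (proj₁ u≁v) u∈Ci v∈Cj) u≁v
  ... | no  i≢j  = adj⇒¬coAdj (C-C u v i j i≢j u∈Ci v∈Cj) u≁v

  A-coneighbour-in-C : ∀ {a u} → InA a → CoAdj G a u → InC u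
  A-coneighbour-in-C a∈A a≁u with kind _
  ... | inA u∈A    = ⊥-elim (adj⇒¬coAdj (same-label⇒adj (proj₁ a≁u) a∈A u∈A) a≁u)
  ... | inB i u∈Bi = ⊥-elim (adj⇒¬coAdj (A-B _ _ i a∈A u∈Bi) a≁u)
  ... | inC i u∈Ci = i , u∈Ci

  A-not-in-stable-triple : ∀ {a x y} → CoAdj G a x → CoAdj G a y → CoAdj G x y → ¬ InA a
  A-not-in-stable-triple a≁x a≁y x≁y a∈A =
    C-clique (A-coneighbour-in-C a∈A a≁x) (A-coneighbour-in-C a∈A a≁y) x≁y

  in-B : ∀ {v} → ¬ InA v → ¬ InC v → InB v
  in-B {v} v∉A v∉C with kind v
  ... | inA v∈A    = ⊥-elim (v∉A v∈A)
  ... | inB i v∈Bi = i , v∈Bi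
  ... | inC i v∈Ci = ⊥-elim (v∉C (i , v∈Ci))

  C-coneighbour-in-B : ∀ {c v} → ¬ InA v → InC c → CoAdj G c v → InB v
  C-coneighbour-in-B v∉A c∈C c≁v = in-B v∉A λ v∈C → C-clique c∈C v∈C c≁v

  no-P3-in-B : ∀ {x y z} → InB x → InB y → InB z → Adj G x y → Adj G y z → ¬ CoAdj G x z
  no-P3-in-B (_ , x∈B) (_ , y∈B) (_ , z∈B) x~y y~z x≁z
    with adj-B-B⇒same-branch x∈B y∈B x~y | adj-B-B⇒same-branch y∈B z∈B y~z
  ... | refl | refl = adj⇒¬coAdj (same-label⇒adj (proj₁ x≁z) x∈B z∈B) x≁z

  P3-meets-C : ∀ {x y z} → ¬ InA y → Adj G x y → Adj G y z → CoAdj G x z →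
               InC x ⊎ InC y ⊎ InC z
  P3-meets-C {x} {y} {z} y∉A x~y y~z x≁z with kind x | kind y | kind z
  ... | _          | inA y∈A    | _          = ⊥-elim (y∉A y∈A)
  ... | inC i x∈Ci | _          | _          = inj₁ (i , x∈Ci)
  ... | _          | inC j y∈Cj | _          = inj₂ (inj₁ (j , y∈Cj))
  ... | _          | _          | inC l z∈Cl = inj₂ (inj₂ (l , z∈Cl))
  ... | inA x∈A    | _          | _          = inj₂ (inj₂ (A-coneighbour-in-C x∈A x≁z))
  ... | _          | _          | inA z∈A    = inj₁ (A-coneighbour-in-C z∈A (coAdj-sym x≁z))
  ... | inB i x∈Bi | inB j y∈Bj | inB l z∈Bl =
    ⊥-elim (no-P3-in-B (i , x∈Bi) (j , y∈Bj) (l , z∈Bl) x~y y~z x≁z)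

  A-C-common-neighbour-in-B : ∀ {a u c j} → InA a → lab c ≡ LC j → Adj G a u → Adj G u c →
                              lab u ≡ LB j
  A-C-common-neighbour-in-B a∈A c∈Cj a~u u~c with kind _
  ... | inA u∈A    = ⊥-elim (adj⇒¬coAdj u~c (A-C-coAdj u∈A c∈Cj))
  ... | inC i u∈Ci = ⊥-elim (adj⇒¬coAdj a~u (A-C-coAdj a∈A u∈Ci))
  ... | inB i u∈Bi with adj-B-C⇒same-branch u∈Bi c∈Cj u~c
  ... | refl = u∈Bi

  branch-nested : ∀ {i b b′} → lab b ≡ LB i → lab b′ ≡ LB i →
                  (∀ {c} → lab c ≡ LC i → Adj G b′ c → Adj G b c) ⊎
                  (∀ {c} → lab c ≡ LC i → Adj G b c → Adj G b′ c)
  branch-nested {i} b∈Bi b′∈Bi with ordering i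
  ... | _ , σ , _ , onto , _ , _ , shrinks , _ with onto _ b∈Bi | onto _ b′∈Bi
  ... | k , refl | l , refl = map (nested k l) (nested l k) (≤ᶠ-total k l)
    where
    nested : ∀ k l → k ≤ᶠ l → ∀ {c} → lab c ≡ LC i → Adj G (σ l) c → Adj G (σ k) c
    nested k l k≤l c∈Ci =
      predecessor-closed⇒downward-closed (λ j → Adj G (σ j) _) (λ j → shrinks j _ c∈Ci) k≤l

  B-has-C-neighbour : ∀ {i b} → lab b ≡ LB i → ∃ λ c → lab c ≡ LC i × Adj G b c
  B-has-C-neighbour {i} b∈Bi with ordering i
  ... | _ , σ , _ , onto , _ , _ , shrinks , (c , c∈Ci , σ-last~c) with onto _ b∈Bi
  ... | k , refl =
    c , c∈Ci ,
    predecessor-closed⇒downward-closed (λ j → Adj G (σ j) c) (λ j → shrinks j c c∈Ci)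
                                       (≤fromℕ k) σ-last~c

  C-has-B-neighbour : ∀ {i c} → lab c ≡ LC i → ∃ λ b → lab b ≡ LB i × Adj G b c
  C-has-B-neighbour {i} c∈Ci with ordering i
  ... | _ , σ , _ , _ , σ∈Bi , σ₀~Ci , _ = σ zero , σ∈Bi zero , σ₀~Ci _ c∈Ci

  no-crossing : ∀ {b b′ c c′} → InB b → InB b′ → Adj G b b′ → InC c → InC c′ →
                Adj G b c → Adj G b′ c′ → CoAdj G b c′ → CoAdj G b′ c → ⊥
  no-crossing (_ , b∈B) (_ , b′∈B) b~b′ (_ , c∈C) (_ , c′∈C) b~c b′~c′ b≁c′ b′≁c
    with adj-B-B⇒same-branch b∈B b′∈B b~b′ | adj-B-C⇒same-branch b∈B c∈C b~c
       | adj-B-C⇒same-branch b′∈B c′∈C b′~c′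
  ... | refl | refl | refl with branch-nested b∈B b′∈B
  ... | inj₁ N[b′]⊆N[b] = adj⇒¬coAdj (N[b′]⊆N[b] c′∈C b′~c′) b≁c′
  ... | inj₂ N[b]⊆N[b′] = adj⇒¬coAdj (N[b]⊆N[b′] c∈C b~c) b′≁c

  K1+P3-isolated∉A : (q : ContainsInduced K1+P3 G) → ¬ InA (proj₁ q zero)
  K1+P3-isolated∉A q =
    A-not-in-stable-triple (coedge q (# 0) (# 1)) (coedge q (# 0) (# 3)) (coedge q (# 1) (# 3))

  K1+P3-isolated∉C : (q : ContainsInduced K1+P3 G) → ¬ InA (proj₁ q (# 2)) →
                     ¬ InC (proj₁ q zero)
  K1+P3-isolated∉C q centre∉A 0∈C
    with P3-meets-C centre∉A (edge q (# 1) (# 2)) (edge q (# 2) (# 3)) (coedge q (# 1) (# 3))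
  ... | inj₁ 1∈C        = C-clique 0∈C 1∈C (coedge q (# 0) (# 1))
  ... | inj₂ (inj₁ 2∈C) = C-clique 0∈C 2∈C (coedge q (# 0) (# 2))
  ... | inj₂ (inj₂ 3∈C) = C-clique 0∈C 3∈C (coedge q (# 0) (# 3))

  free-if-farP3s : {W : Set} {H : W → W → Bool} (far : W → Vec W 3) → FarP3s H far →
                   W → Free H G
  free-if-farP3s far farP3s w e =
    no-P3-in-B (∈B _) (∈B _) (∈B _) (edge q (# 1) (# 2)) (edge q (# 2) (# 3)) (coedge q (# 1) (# 3))
    where
    q : ContainsInduced K1+P3 G
    q = containsInduced-∘ (farP3s w) e
    ∉A : ∀ v → ¬ InA (proj₁ e v)
    ∉A = at-every-vertex (¬_ ∘ InA) far farP3s K1+P3-isolated∉A e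
    ∈B : ∀ v → InB (proj₁ e v)
    ∈B v = in-B (∉A v) (K1+P3-isolated∉C (containsInduced-∘ (farP3s v) e) (∉A _))

  C4-vertex∉A : (e : ContainsInduced C4 G) → ¬ InA (proj₁ e zero)
  C4-vertex∉A e 0∈A with A-coneighbour-in-C 0∈A (coedge e (# 0) (# 2))
  ... | j , 2∈Cj =
    adj⇒¬coAdj (same-label⇒adj (proj₁ 1≁3) (in-Bj (# 1)) (in-Bj (# 3))) 1≁3
    where
    1≁3 : CoAdj G (proj₁ e (# 1)) (proj₁ e (# 3))
    1≁3 = coedge e (# 1) (# 3)
    in-Bj : ∀ v → {T (C4 (# 0) v)} → {T (C4 v (# 2))} → lab (proj₁ e v) ≡ LB j
    in-Bj v {0v} {v2} =
      A-C-common-neighbour-in-B 0∈A 2∈Cj (edge e (# 0) v {0v}) (edge e v (# 2) {v2})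

  C4-no-adjacent-C-pair : (e : ContainsInduced C4 G) → ¬ InA (proj₁ e (# 2)) →
                          ¬ InA (proj₁ e (# 3)) → InC (proj₁ e (# 0)) → ¬ InC (proj₁ e (# 1))
  C4-no-adjacent-C-pair e 2∉A 3∉A 0∈C 1∈C =
    no-crossing 3∈B 2∈B (edge e (# 3) (# 2)) 0∈C 1∈C (edge e (# 3) (# 0)) (edge e (# 2) (# 1))
                (coedge e (# 3) (# 1)) (coedge e (# 2) (# 0))
    where
    2∈B : InB (proj₁ e (# 2))
    2∈B = C-coneighbour-in-B 2∉A 0∈C (coedge e (# 0) (# 2))
    3∈B : InB (proj₁ e (# 3))
    3∈B = C-coneighbour-in-B 3∉A 1∈C (coedge e (# 1) (# 3))

  C4-vertex∉C : (e : ContainsInduced C4 G) → (∀ v → ¬ InA (proj₁ e v)) → ¬ InC (proj₁ e zero)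
  C4-vertex∉C e ∉A 0∈C
    with P3-meets-C (∉A (# 2)) (edge e (# 1) (# 2)) (edge e (# 2) (# 3)) (coedge e (# 1) (# 3))
  ... | inj₁ 1∈C        = C4-no-adjacent-C-pair e (∉A (# 2)) (∉A (# 3)) 0∈C 1∈C
  ... | inj₂ (inj₁ 2∈C) = C-clique 0∈C 2∈C (coedge e (# 0) (# 2))
  ... | inj₂ (inj₂ 3∈C) =
    C4-no-adjacent-C-pair (containsInduced-∘ (C4-rotation-induced (# 3)) e)
                          (∉A (# 1)) (∉A (# 2)) 3∈C 0∈C

  C4-free : Free C4 G
  C4-free e =
    no-P3-in-B (∈B (# 0)) (∈B (# 1)) (∈B (# 2)) (edge e (# 0) (# 1)) (edge e (# 1) (# 2))
               (coedge e (# 0) (# 2))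
    where
    ∉A : ∀ v → ¬ InA (proj₁ e v)
    ∉A = at-every-vertex (¬_ ∘ InA) C4-rotation C4-rotation-induced C4-vertex∉A e
    ∈B : ∀ v → InB (proj₁ e v)
    ∈B v = in-B (∉A v) (C4-vertex∉C (containsInduced-∘ (C4-rotation-induced v) e)
                                    (∉A ∘ lookup (v ∷ C4-rotation v)))

  twoP3-free : Free twoP3 G
  twoP3-free = free-if-farP3s twoP3-far-P3 twoP3-farP3s (# 0)

  C6-free : Free C6 G
  C6-free = free-if-farP3s cycle-far-P3 C6-farP3s (# 0)

  C7-free : Free C7 G
  C7-free = free-if-farP3s cycle-far-P3 C7-farP3s (# 0)

  T0-free : Free T0 G
  T0-free = free-if-farP3s T0-far-P3 T0-farP3s (# 0)

  pentagon-copy : ContainsInduced (pentagon t) G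
  pentagon-copy = f , f-injective , f-preserves
    where
    branch-edge : ∀ i → Σ V λ b → Σ V λ c → lab b ≡ LB i × lab c ≡ LC i × Adj G b c
    branch-edge i = let b , b∈Bi = nonempty (LB i); c , c∈Ci , b~c = B-has-C-neighbour b∈Bi
                    in b , c , b∈Bi , c∈Ci , b~c

    f : PentV t → V
    f pa     = hub
    f (pb i) = proj₁ (branch-edge i)
    f (pc i) = proj₁ (proj₂ (branch-edge i))

    label : PentV t → VLabel t
    label pa     = LA
    label (pb i) = LB i
    label (pc i) = LC i

    f-label : ∀ x → lab (f x) ≡ label x
    f-label pa     = hub∈A
    f-label (pb i) = proj₁ (proj₂ (proj₂ (branch-edge i)))
    f-label (pc i) = proj₁ (proj₂ (proj₂ (proj₂ (branch-edge i))))

    bᵢ~cᵢ : ∀ i → Adj G (f (pb i)) (f (pc i))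
    bᵢ~cᵢ i = proj₂ (proj₂ (proj₂ (proj₂ (branch-edge i))))

    label-injective : ∀ x y → label x ≡ label y → x ≡ y
    label-injective pa     pa     refl = refl
    label-injective (pb i) (pb i) refl = refl
    label-injective (pc i) (pc i) refl = refl

    f-injective : ∀ x y → f x ≡ f y → x ≡ y
    f-injective x y fx≡fy =
      label-injective x y (trans (≡.sym (f-label x)) (trans (≡.cong lab fx≡fy) (f-label y)))

    f-preserves : ∀ x y → pentagon t x y ≡ adj G (f x) (f y)
    f-preserves pa     pa     = ≡.sym (irrefl G hub)
    f-preserves pa     (pb i) = ≡.sym (A-B _ _ i hub∈A (f-label (pb i)))
    f-preserves pa     (pc i) = ≡.sym (proj₂ (A-C-coAdj hub∈A (f-label (pc i))))
    f-preserves (pb i) pa     = ≡.sym (adj-sym (A-B _ _ i hub∈A (f-label (pb i))))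
    f-preserves (pc i) pa     = ≡.sym (proj₂ (coAdj-sym (A-C-coAdj hub∈A (f-label (pc i)))))
    f-preserves (pb i) (pb j) with i ≟ j
    ... | yes refl = ≡.sym (irrefl G _)
    ... | no  i≢j  = ≡.sym (proj₂ (B-B-coAdj i≢j (f-label (pb i)) (f-label (pb j))))
    f-preserves (pb i) (pc j) with i ≟ j
    ... | yes refl = ≡.sym (bᵢ~cᵢ i)
    ... | no  i≢j  = ≡.sym (proj₂ (B-C-coAdj i≢j (f-label (pb i)) (f-label (pc j))))
    f-preserves (pc j) (pb i) with i ≟ j
    ... | yes refl = ≡.sym (adj-sym (bᵢ~cᵢ i))
    ... | no  i≢j  = ≡.sym (proj₂ (coAdj-sym (B-C-coAdj i≢j (f-label (pb i)) (f-label (pc j)))))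
    f-preserves (pc i) (pc j) with i ≟ j
    ... | yes refl = ≡.sym (irrefl G _)
    ... | no  i≢j  = ≡.sym (C-C _ _ i j i≢j (f-label (pc i)) (f-label (pc j)))

module VillaWithTwoBranches {k : ℕ} {G : Graph} (villa : IsVilla (suc (suc k)) G) where
  open IsVilla villa
  open GraphProperties G
  open Villa villa

  other : Fin (suc (suc k)) → Fin (suc (suc k))
  other i = punchIn i zero

  other≢ : ∀ i → i ≢ other i
  other≢ i = punchInᵢ≢i i zero ∘ ≡.sym

  anticonnected : Anticonnected G
  anticonnected u v = coReach-trans (to-hub u) (coReach-sym (to-hub v))
    where
    C-to-hub : ∀ {c i} → lab c ≡ LC i → CoReach G c hub
    C-to-hub c∈Ci = step (coAdj-sym (A-C-coAdj hub∈A c∈Ci)) here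

    to-hub : ∀ u → CoReach G u hub
    to-hub u with kind u
    ... | inA u∈A    = let c , c∈C = nonempty (LC zero)
                       in step (A-C-coAdj u∈A c∈C) (C-to-hub c∈C)
    ... | inB i u∈Bi = let c , c∈C = nonempty (LC (other i))
                       in step (B-C-coAdj (other≢ i) u∈Bi c∈C) (C-to-hub c∈C)
    ... | inC i u∈Ci = C-to-hub u∈Ci

  no-simplicial : ∀ v → ¬ Simplicial G v
  no-simplicial v with kind v
  ... | inA v∈A =
    let b , b∈B₀ = nonempty (LB zero); b′ , b′∈B₁ = nonempty (LB (suc zero))
    in coAdj-neighbours⇒¬simplicial (A-B _ _ _ v∈A b∈B₀) (A-B _ _ _ v∈A b′∈B₁)
                                    (B-B-coAdj (λ ()) b∈B₀ b′∈B₁)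
  ... | inB i v∈Bi =
    let c , c∈Ci , v~c = B-has-C-neighbour v∈Bi
    in coAdj-neighbours⇒¬simplicial (adj-sym (A-B _ _ _ hub∈A v∈Bi)) v~c (A-C-coAdj hub∈A c∈Ci)
  ... | inC i v∈Ci =
    let b , b∈Bi , b~v = C-has-B-neighbour v∈Ci; c , c∈C = nonempty (LC (other i))
    in coAdj-neighbours⇒¬simplicial (adj-sym b~v) (C-C _ _ _ _ (other≢ i) v∈Ci c∈C)
                                    (B-C-coAdj (other≢ i) b∈Bi c∈C)

  no-universal : ∀ v → ¬ Universal G v
  no-universal v with kind v
  ... | inA v∈A    = let c , c∈C = nonempty (LC zero)
                     in coAdj⇒¬universal (A-C-coAdj v∈A c∈C)
  ... | inB i v∈Bi = let b , b∈B = nonempty (LB (other i))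
                     in coAdj⇒¬universal (B-B-coAdj (other≢ i) v∈Bi b∈B)
  ... | inC i v∈Ci = coAdj⇒¬universal (coAdj-sym (A-C-coAdj hub∈A v∈Ci))

proposition5p3 : (t : ℕ) → 3 ≤ t → (G : Graph) → IsVilla t G →
    Free twoP3 G × Free C4 G × Free C6 G × Free C7 G × Free T0 G ×
    ContainsInduced (pentagon t) G ×
    Anticonnected G ×
    (∀ (v : Fin (n G)) → ¬ Simplicial G v) ×
    (∀ (v : Fin (n G)) → ¬ Universal G v)
proposition5p3 (suc (suc _)) (s≤s (s≤s _)) G villa =
  twoP3-free , C4-free , C6-free , C7-free , T0-free , pentagon-copy ,
  anticonnected , no-simplicial , no-universal
  where
  open Villa villa
  open VillaWithTwoBranches villa
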